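{- Let $H$ be a graph containing adjacent vertices $u,v$, and let $H'=H-\{u,v\}$ be $3$-colorable. Suppose $u$ has exactly one neighbor $x$ in $V(H')$ and $v$ has exactly one neighbor $y$ in $V(H')$, where $y\in V(H')\setminus N[x]$ (with $N[x]$ the closed neighborhood of $x$ in $H'$). If $g_3(H')\leq 2$, then $g_3(H)\leq 2$.
   Context: For a graph $H$ and $k\geq\chi(H)$, a proper $k$-coloring is a map $V(H)\to[k]$ giving adjacent vertices different colors. For a positive integer $j$, $G^j_k(H)$ has the proper $k$-colorings of $H$ as vertices, two distinct colorings adjacent if $H$ contains a connected subgraph on at most $j$ vertices containing all vertices where they differ; $g_k(H)$ is the least $j\geq1$ with $G^j_k(H)$ connected. -}

module Defs where

open import Data.Nat using (ℕ; _≤_)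
open import Data.Fin using (Fin)
open import Data.List using (List; length)
open import Data.List.Membership.Propositional using (_∈_)
open import Data.Product using (Σ; ∃; _×_; proj₁)
open import Relation.Binary.PropositionalEquality using (_≡_; _≢_)
open import Relation.Binary.Construct.Closure.ReflexiveTransitive using (Star)
open import Relation.Nullary using (¬_)

record Graph (V : Set) : Set₁ where
  field
    Adj    : V → V → Set
    sym    : ∀ {a b} → Adj a b → Adj b a
    irrefl : ∀ {a} → ¬ Adj a a
open Graph public

DelV : ∀ {n} → Fin n → Fin n → Set
DelV {n} u v = Σ (Fin n) λ w → w ≢ u × w ≢ v

delete2 : ∀ {n} → Graph (Fin n) → (u v : Fin n) → Graph (DelV u v)
delete2 H u v = record
  { Adj = λ a b → Adj H (proj₁ a) (proj₁ b)
  ; sym = sym H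
  ; irrefl = irrefl H }

IsProper : ∀ {V} → Graph V → (k : ℕ) → (V → Fin k) → Set
IsProper H k c = ∀ a b → Adj H a b → c a ≢ c b

Coloring : ∀ {V} → Graph V → ℕ → Set
Coloring {V} H k = Σ (V → Fin k) (IsProper H k)

Colorable : ∀ {V} → Graph V → ℕ → Set
Colorable H k = Coloring H k

ConnectedOn : ∀ {V} → Graph V → List V → Set
ConnectedOn {V} H S =
  ∀ a b → a ∈ S → b ∈ S → Star (λ p q → p ∈ S × q ∈ S × Adj H p q) a b

-- Adjacency in G^j_k(H): some connected subgraph of H on at most j vertices
-- (listed by S) contains every vertex where the two colorings differ.
GAdj : ∀ {V} (H : Graph V) (j k : ℕ) → Coloring H k → Coloring H k → Set
GAdj {V} H j k c d =
  Σ (List V) λ S → length S ≤ j × ConnectedOn H S ×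
    (∀ w → proj₁ c w ≢ proj₁ d w → w ∈ S)

GConnected : ∀ {V} (H : Graph V) (j k : ℕ) → Set
GConnected H j k = ∀ c d → Star (GAdj H j k) c d

-- g_k(H) ≤ j : the least j' ≥ 1 with G^{j'}_k(H) connected is at most j,
-- i.e. some j' with 1 ≤ j' ≤ j has G^{j'}_k(H) connected.
gLe : ∀ {V} (H : Graph V) (k j : ℕ) → Set
gLe H k j = ∃ λ j' → 1 ≤ j' × j' ≤ j × GConnected H j' k

module Submission where

-- A 3-colouring a of H' together with colours cu, cv for u and v gives a map
-- extend a cu cv on V(H); it is a proper colouring of H as soon as cu ≠ cv,
-- cu ≠ a(x) and cv ≠ a(y).  A step a → b of G²₃(H') recolours a connected set
-- of at most two vertices; such a set contains two distinct vertices only if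
-- they are adjacent, so the step keeps the colour of x or the colour of y.
-- Hence there are colours cu ≠ cv for u, v compatible with both a and b, and
-- the step lifts to two steps of G²₃(H): first recolour the edge uv, then
-- perform the step of H'.  Lifting a walk restrict c →* restrict d of
-- G²₃(H') in this way and recolouring uv once more joins any two colourings
-- c, d of H.

open import Defs
open import Data.Nat using (ℕ; _≤_; z≤n; s≤s)
open import Data.Nat.Properties using (≤-trans; ≤-refl)
open import Data.Fin using (Fin; zero; suc; _≟_)
open import Data.Product using (Σ; _×_; _,_; proj₁; proj₂)
open import Data.Sum using (_⊎_; inj₁; inj₂)
open import Data.Empty using (⊥-elim)
open import Data.List using (List; []; _∷_; map; length)
open import Data.List.Properties using (length-map)
open import Data.List.Relation.Unary.Any using (here; there)
open import Data.List.Membership.Propositional using (_∈_)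
open import Data.List.Membership.Propositional.Properties using (∈-map⁺; ∈-map⁻)
open import Relation.Binary.PropositionalEquality as ≡ using (_≡_; _≢_; refl; trans; subst)
open import Relation.Binary.Construct.Closure.ReflexiveTransitive using (Star; ε; _◅_; _◅◅_; gmap)
  renaming (map to Star-map)
open import Relation.Nullary using (¬_; yes; no)

thirdColour : (α β : Fin 3) → Σ (Fin 3) λ γ → γ ≢ α × γ ≢ β
thirdColour zero             zero             = suc zero , (λ ()) , (λ ())
thirdColour zero             (suc zero)       = suc (suc zero) , (λ ()) , (λ ())
thirdColour zero             (suc (suc zero)) = suc zero , (λ ()) , (λ ())
thirdColour (suc zero)       zero             = suc (suc zero) , (λ ()) , (λ ())
thirdColour (suc zero)       (suc zero)       = zero , (λ ()) , (λ ())
thirdColour (suc zero)       (suc (suc zero)) = zero , (λ ()) , (λ ())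
thirdColour (suc (suc zero)) zero             = suc zero , (λ ()) , (λ ())
thirdColour (suc (suc zero)) (suc zero)       = zero , (λ ()) , (λ ())
thirdColour (suc (suc zero)) (suc (suc zero)) = zero , (λ ()) , (λ ())

-- Two distinct colours cu, cv with cu ∉ {α, α'} and cv ∉ {β, β'} exist as
-- long as one of the two forbidden pairs is a single colour: that side
-- forbids one colour only and can additionally avoid the other side's choice.
twoAvoidingColours : (α α' β β' : Fin 3) → α ≡ α' ⊎ β ≡ β' →
  Σ (Fin 3) λ cu → Σ (Fin 3) λ cv →
    cu ≢ cv × cu ≢ α × cu ≢ α' × cv ≢ β × cv ≢ β'
twoAvoidingColours α α' β β' (inj₁ refl) with thirdColour β β'
... | cv , cv≢β , cv≢β' with thirdColour α cv
... | cu , cu≢α , cu≢cv = cu , cv , cu≢cv , cu≢α , cu≢α , cv≢β , cv≢β'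
twoAvoidingColours α α' β β' (inj₂ refl) with thirdColour α α'
... | cu , cu≢α , cu≢α' with thirdColour β cu
... | cv , cv≢β , cv≢cu =
  cu , cv , (λ e → cv≢cu (≡.sym e)) , cu≢α , cu≢α' , cv≢β , cv≢β

GAdj-weaken : ∀ {V} {G : Graph V} {j j' k} {c d : Coloring G k} →
  j ≤ j' → GAdj G j k c d → GAdj G j' k c d
GAdj-weaken j≤j' (S , len , conn , diff) = S , ≤-trans len j≤j' , conn , diff

gLe⇒GConnected : ∀ {V} (G : Graph V) {k j} → gLe G k j → GConnected G j k
gLe⇒GConnected G (j' , _ , j'≤j , conn) c d =
  Star-map (λ {c₁} {c₂} → GAdj-weaken {G = G} {c = c₁} {d = c₂} j'≤j) (conn c d)

edgeConnected : ∀ {V} (G : Graph V) {s t : V} → Adj G s t → ConnectedOn G (s ∷ t ∷ [])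
edgeConnected G st _ _ (here refl)         (here refl)         = ε
edgeConnected G st _ _ (here refl)         (there (here refl)) = (here refl , there (here refl) , st) ◅ ε
edgeConnected G st _ _ (there (here refl)) (here refl)         = (there (here refl) , here refl , sym G st) ◅ ε
edgeConnected G st _ _ (there (here refl)) (there (here refl)) = ε

GAdj-edge : ∀ {V} (G : Graph V) {k} {s t : V} {c d : Coloring G k} → Adj G s t →
  (∀ w → proj₁ c w ≢ proj₁ d w → w ≡ s ⊎ w ≡ t) → GAdj G 2 k c d
GAdj-edge G {s = s} {t} st onEdge =
  s ∷ t ∷ [] , ≤-refl , edgeConnected G st , λ w ne → inEdge (onEdge w ne)
  where
  inEdge : ∀ {w} → w ≡ s ⊎ w ≡ t → w ∈ s ∷ t ∷ []
  inEdge (inj₁ refl) = here refl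
  inEdge (inj₂ refl) = there (here refl)

onlyTwo : ∀ {A : Set} {S : List A} {s t p : A} → length S ≤ 2 →
  s ∈ S → t ∈ S → s ≢ t → p ∈ S → p ≡ s ⊎ p ≡ t
onlyTwo {S = _ ∷ _ ∷ _ ∷ _} (s≤s (s≤s ())) _ _ _ _
onlyTwo _ (here refl)         (here refl)         s≢t _ = ⊥-elim (s≢t refl)
onlyTwo _ (there (here refl)) (there (here refl)) s≢t _ = ⊥-elim (s≢t refl)
onlyTwo _ (here refl)         (there (here refl)) _ (here refl)         = inj₁ refl
onlyTwo _ (here refl)         (there (here refl)) _ (there (here refl)) = inj₂ refl
onlyTwo _ (there (here refl)) (here refl)         _ (here refl)         = inj₂ refl
onlyTwo _ (there (here refl)) (here refl)         _ (there (here refl)) = inj₁ refl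

-- Two distinct vertices of a connected set of size at most two are adjacent:
-- the first step of a path from s to t must already reach t.
smallConnected⇒Adj : ∀ {V} (G : Graph V) {S : List V} {s t : V} →
  ConnectedOn G S → length S ≤ 2 → s ∈ S → t ∈ S → s ≢ t → Adj G s t
smallConnected⇒Adj G {S} {s} {t} conn len s∈ t∈ s≢t with conn s t s∈ t∈
... | ε = ⊥-elim (s≢t refl)
... | (_ , q∈ , adj) ◅ _ with onlyTwo len s∈ t∈ s≢t q∈
...   | inj₁ refl = ⊥-elim (irrefl G adj)
...   | inj₂ refl = adj

recoloured⇒Adj : ∀ {V} (G : Graph V) {k} {c d : Coloring G k} {s t : V} →
  GAdj G 2 k c d → proj₁ c s ≢ proj₁ d s → proj₁ c t ≢ proj₁ d t → s ≢ t → Adj G s t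
recoloured⇒Adj G (S , len , conn , diff) ds dt s≢t =
  smallConnected⇒Adj G conn len (diff _ ds) (diff _ dt) s≢t

connected-map : ∀ {V W} (G : Graph V) (K : Graph W) (φ : V → W) →
  (∀ {a b} → Adj G a b → Adj K (φ a) (φ b)) →
  ∀ S → ConnectedOn G S → ConnectedOn K (map φ S)
connected-map G K φ hom S conn _ _ a∈ b∈ with ∈-map⁻ φ a∈ | ∈-map⁻ φ b∈
... | a , a∈S , refl | b , b∈S , refl =
  gmap φ (λ { (p∈ , q∈ , adj) → ∈-map⁺ φ p∈ , ∈-map⁺ φ q∈ , hom adj })
    (conn a b a∈S b∈S)

module Deletion {n : ℕ} (H : Graph (Fin n)) (u v : Fin n) (u≢v : u ≢ v) where

  D : Set
  D = DelV u v

  H' : Graph D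
  H' = delete2 H u v

  classify : ∀ w → w ≡ u ⊎ w ≡ v ⊎ (w ≢ u × w ≢ v)
  classify w with w ≟ u | w ≟ v
  ... | yes w≡u | _       = inj₁ w≡u
  ... | no _    | yes w≡v = inj₂ (inj₁ w≡v)
  ... | no w≢u  | no w≢v  = inj₂ (inj₂ (w≢u , w≢v))

  extend : ∀ {k} → (D → Fin k) → Fin k → Fin k → Fin n → Fin k
  extend a cu cv w with w ≟ u | w ≟ v
  ... | yes _  | _      = cu
  ... | no _   | yes _  = cv
  ... | no w≢u | no w≢v = a (w , w≢u , w≢v)

  extend-u : ∀ {k} (a : D → Fin k) cu cv → extend a cu cv u ≡ cu
  extend-u a cu cv with u ≟ u
  ... | yes _   = refl
  ... | no u≢u  = ⊥-elim (u≢u refl)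

  extend-v : ∀ {k} (a : D → Fin k) cu cv → extend a cu cv v ≡ cv
  extend-v a cu cv with v ≟ u | v ≟ v
  ... | yes v≡u | _       = ⊥-elim (u≢v (≡.sym v≡u))
  ... | no _    | yes _   = refl
  ... | no _    | no v≢v  = ⊥-elim (v≢v refl)

  extend-inside : ∀ {k} (a : D → Fin k) cu cv w → w ≢ u → w ≢ v →
    Σ (w ≢ u) λ p → Σ (w ≢ v) λ q → extend a cu cv w ≡ a (w , p , q)
  extend-inside a cu cv w w≢u w≢v with w ≟ u | w ≟ v
  ... | yes w≡u | _       = ⊥-elim (w≢u w≡u)
  ... | no _    | yes w≡v = ⊥-elim (w≢v w≡v)
  ... | no p    | no q    = p , q , refl

  extend-agree : ∀ {k} (a : D → Fin k) cu cv cu' cv' w → w ≢ u → w ≢ v →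
    extend a cu cv w ≡ extend a cu' cv' w
  extend-agree a cu cv cu' cv' w w≢u w≢v with w ≟ u | w ≟ v
  ... | yes w≡u | _       = ⊥-elim (w≢u w≡u)
  ... | no _    | yes w≡v = ⊥-elim (w≢v w≡v)
  ... | no _    | no _    = refl

  extend-diff : ∀ {k} (a b : D → Fin k) cu cv w → extend a cu cv w ≢ extend b cu cv w →
    Σ (w ≢ u) λ p → Σ (w ≢ v) λ q → a (w , p , q) ≢ b (w , p , q)
  extend-diff a b cu cv w ne with w ≟ u | w ≟ v
  ... | yes _ | _     = ⊥-elim (ne refl)
  ... | no _  | yes _ = ⊥-elim (ne refl)
  ... | no p  | no q  = p , q , ne

  extend-proper : ∀ {k} (a : D → Fin k) cu cv → IsProper H' k a →
    (∀ w → Adj H u w → extend a cu cv u ≢ extend a cu cv w) →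
    (∀ w → Adj H v w → extend a cu cv v ≢ extend a cu cv w) →
    IsProper H k (extend a cu cv)
  extend-proper a cu cv proper atU atV w z adj with classify w | classify z
  ... | inj₁ refl        | _                = atU z adj
  ... | inj₂ (inj₁ refl) | _                = atV z adj
  ... | inj₂ (inj₂ _)    | inj₁ refl        = λ e → atU w (sym H adj) (≡.sym e)
  ... | inj₂ (inj₂ _)    | inj₂ (inj₁ refl) = λ e → atV w (sym H adj) (≡.sym e)
  ... | inj₂ (inj₂ (w≢u , w≢v)) | inj₂ (inj₂ (z≢u , z≢v))
    with extend-inside a cu cv w w≢u w≢v | extend-inside a cu cv z z≢u z≢v
  ...   | p , q , ew | p' , q' , ez =
    λ e → proper (w , p , q) (z , p' , q') adj (trans (≡.sym ew) (trans e ez))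

  restrict : ∀ {k} → Coloring H k → Coloring H' k
  restrict (c , proper) = (λ s → c (proj₁ s)) , (λ s t adj → proper (proj₁ s) (proj₁ t) adj)

  Extends : ∀ {k} → (Fin n → Fin k) → (D → Fin k) → Set
  Extends f a = ∀ w → w ≢ u → w ≢ v → f w ≡ extend a (f u) (f v) w

  extend-extends : ∀ {k} (a : D → Fin k) cu cv → Extends (extend a cu cv) a
  extend-extends a cu cv = extend-agree a cu cv _ _

  restrict-extends : ∀ {k} (c : Coloring H k) → Extends (proj₁ c) (proj₁ (restrict c))
  restrict-extends c w w≢u w≢v with w ≟ u | w ≟ v
  ... | yes w≡u | _       = ⊥-elim (w≢u w≡u)
  ... | no _    | yes w≡v = ⊥-elim (w≢v w≡v)
  ... | no _    | no _    = refl

  extensions-differ : ∀ {k} (a : D → Fin k) (f g : Fin n → Fin k) →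
    Extends f a → Extends g a → ∀ w → f w ≢ g w → w ≡ u ⊎ w ≡ v
  extensions-differ a f g ef eg w ne with classify w
  ... | inj₁ w≡u               = inj₁ w≡u
  ... | inj₂ (inj₁ w≡v)        = inj₂ w≡v
  ... | inj₂ (inj₂ (w≢u , w≢v)) = ⊥-elim (ne (begin
    f w                        ≡⟨ ef w w≢u w≢v ⟩
    extend a (f u) (f v) w     ≡⟨ extend-agree a _ _ _ _ w w≢u w≢v ⟩
    extend a (g u) (g v) w     ≡⟨ ≡.sym (eg w w≢u w≢v) ⟩
    g w                        ∎))
    where open ≡.≡-Reasoning

  GAdj-extend : ∀ {j k} {a b : Coloring H' k} {cu cv} →
    (pa : IsProper H k (extend (proj₁ a) cu cv)) (pb : IsProper H k (extend (proj₁ b) cu cv)) →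
    GAdj H' j k a b → GAdj H j k (_ , pa) (_ , pb)
  GAdj-extend {j} {a = a} {b} {cu} {cv} _ _ (S , len , conn , diff) =
    map proj₁ S ,
    subst (_≤ j) (≡.sym (length-map proj₁ S)) len ,
    connected-map H' H proj₁ (λ adj → adj) S conn ,
    diff'
    where
    diff' : ∀ w → extend (proj₁ a) cu cv w ≢ extend (proj₁ b) cu cv w → w ∈ map proj₁ S
    diff' w ne with extend-diff (proj₁ a) (proj₁ b) cu cv w ne
    ... | p , q , d = ∈-map⁺ proj₁ (diff (w , p , q) d)

module Lifting {n : ℕ} (H : Graph (Fin n)) (u v : Fin n) (uv : Adj H u v)
  (x y : Fin n) (x≢u : x ≢ u) (x≢v : x ≢ v) (y≢u : y ≢ u) (y≢v : y ≢ v)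
  (onlyX : ∀ w → w ≢ u → w ≢ v → Adj H u w → w ≡ x)
  (onlyY : ∀ w → w ≢ u → w ≢ v → Adj H v w → w ≡ y)
  (y≢x : y ≢ x) (x≁y : ¬ Adj H x y) where

  open Deletion H u v (λ u≡v → irrefl H (subst (Adj H u) (≡.sym u≡v) uv))

  colourAt : (D → Fin 3) → Fin n → Fin 3
  colourAt a w = extend a zero zero w

  -- A step of G²₃(H') keeps the colour of x or the colour of y, since x and
  -- y are distinct and non-adjacent.
  keepsXorY : ∀ {a b : Coloring H' 3} → GAdj H' 2 3 a b →
    colourAt (proj₁ a) x ≡ colourAt (proj₁ b) x ⊎ colourAt (proj₁ a) y ≡ colourAt (proj₁ b) y
  keepsXorY {a} {b} g with colourAt (proj₁ a) x ≟ colourAt (proj₁ b) x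
                          | colourAt (proj₁ a) y ≟ colourAt (proj₁ b) y
  ... | yes ex | _      = inj₁ ex
  ... | no _   | yes ey = inj₂ ey
  ... | no dx  | no dy
    with extend-diff (proj₁ a) (proj₁ b) zero zero x dx
       | extend-diff (proj₁ a) (proj₁ b) zero zero y dy
  ...   | p , q , dx' | p' , q' , dy' =
    ⊥-elim (x≁y (recoloured⇒Adj H' {c = a} {d = b} g dx' dy' x̂≢ŷ))
    where
    x̂≢ŷ : (x , p , q) ≢ (y , p' , q')
    x̂≢ŷ e = y≢x (≡.cong proj₁ (≡.sym e))

  Suitable : (D → Fin 3) → Fin 3 → Fin 3 → Set
  Suitable a cu cv = cu ≢ cv × cu ≢ colourAt a x × cv ≢ colourAt a y

  extendColouring : (a : Coloring H' 3) {cu cv : Fin 3} → Suitable (proj₁ a) cu cv → Coloring H 3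
  extendColouring (a , proper) {cu} {cv} (cu≢cv , cu≢ax , cv≢ay) =
    extend a cu cv , extend-proper a cu cv proper atU atV
    where
    u≠v : extend a cu cv u ≢ extend a cu cv v
    u≠v e = cu≢cv (trans (≡.sym (extend-u a cu cv)) (trans e (extend-v a cu cv)))
    u≠x : extend a cu cv u ≢ extend a cu cv x
    u≠x e = cu≢ax (trans (≡.sym (extend-u a cu cv)) (trans e (extend-agree a cu cv zero zero x x≢u x≢v)))
    v≠y : extend a cu cv v ≢ extend a cu cv y
    v≠y e = cv≢ay (trans (≡.sym (extend-v a cu cv)) (trans e (extend-agree a cu cv zero zero y y≢u y≢v)))
    atU : ∀ w → Adj H u w → extend a cu cv u ≢ extend a cu cv w
    atU w adj with classify w
    ... | inj₁ refl        = ⊥-elim (irrefl H adj)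
    ... | inj₂ (inj₁ refl) = u≠v
    ... | inj₂ (inj₂ (w≢u , w≢v)) with onlyX w w≢u w≢v adj
    ...   | refl = u≠x
    atV : ∀ w → Adj H v w → extend a cu cv v ≢ extend a cu cv w
    atV w adj with classify w
    ... | inj₁ refl        = λ e → u≠v (≡.sym e)
    ... | inj₂ (inj₁ refl) = ⊥-elim (irrefl H adj)
    ... | inj₂ (inj₂ (w≢u , w≢v)) with onlyY w w≢u w≢v adj
    ...   | refl = v≠y

  liftStep : ∀ {a b : Coloring H' 3} → GAdj H' 2 3 a b →
    (c : Coloring H 3) → Extends (proj₁ c) (proj₁ a) →
    Σ (Coloring H 3) λ c' → Extends (proj₁ c') (proj₁ b) × Star (GAdj H 2 3) c c'
  liftStep {a} {b} g c c-ext
    with twoAvoidingColours (colourAt (proj₁ a) x) (colourAt (proj₁ b) x)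
                            (colourAt (proj₁ a) y) (colourAt (proj₁ b) y) (keepsXorY {a} {b} g)
  ... | cu , cv , cu≢cv , cu≢ax , cu≢bx , cv≢ay , cv≢by =
    cb , extend-extends (proj₁ b) cu cv , _◅_ {j = ca} recolourUV (performStep ◅ ε)
    where
    ca cb : Coloring H 3
    ca = extendColouring a (cu≢cv , cu≢ax , cv≢ay)
    cb = extendColouring b (cu≢cv , cu≢bx , cv≢by)
    performStep : GAdj H 2 3 ca cb
    performStep = GAdj-extend {a = a} {b = b} (proj₂ ca) (proj₂ cb) g
    recolourUV : GAdj H 2 3 c ca
    recolourUV = GAdj-edge H {c = c} {d = ca} uv
      (extensions-differ (proj₁ a) (proj₁ c) (proj₁ ca) c-ext (extend-extends (proj₁ a) cu cv))

  liftWalk : ∀ {a b : Coloring H' 3} → Star (GAdj H' 2 3) a b →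
    (c : Coloring H 3) → Extends (proj₁ c) (proj₁ a) →
    Σ (Coloring H 3) λ c' → Extends (proj₁ c') (proj₁ b) × Star (GAdj H 2 3) c c'
  liftWalk ε c c-ext = c , c-ext , ε
  liftWalk {a} (_◅_ {j = m} g gs) c c-ext with liftStep {a} {m} g c c-ext
  ... | c₁ , c₁-ext , walk₁ with liftWalk gs c₁ c₁-ext
  ...   | c₂ , c₂-ext , walk₂ = c₂ , c₂-ext , walk₁ ◅◅ walk₂

  connected : GConnected H' 2 3 → GConnected H 2 3
  connected conn' c d with liftWalk (conn' (restrict c) (restrict d)) c (restrict-extends c)
  ... | c' , c'-ext , walk =
    walk ◅◅ (GAdj-edge H {c = c'} {d = d} uv differOnUV ◅ ε)
    where
    differOnUV : ∀ w → proj₁ c' w ≢ proj₁ d w → w ≡ u ⊎ w ≡ v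
    differOnUV = extensions-differ (proj₁ (restrict d)) (proj₁ c') (proj₁ d) c'-ext (restrict-extends d)

mainTheorem9 : (n : ℕ) (H : Graph (Fin n)) (u v : Fin n) → Adj H u v →
    Colorable (delete2 H u v) 3 →
    (x y : Fin n) → x ≢ u → x ≢ v → y ≢ u → y ≢ v →
    Adj H u x → (∀ w → w ≢ u → w ≢ v → Adj H u w → w ≡ x) →
    Adj H v y → (∀ w → w ≢ u → w ≢ v → Adj H v w → w ≡ y) →
    y ≢ x → ¬ Adj H x y →
    gLe (delete2 H u v) 3 2 → gLe H 3 2
mainTheorem9 n H u v uv _ x y x≢u x≢v y≢u y≢v _ onlyX _ onlyY y≢x x≁y g'≤2 =
  2 , s≤s z≤n , ≤-refl ,
  Lifting.connected H u v uv x y x≢u x≢v y≢u y≢v onlyX onlyY y≢x x≁y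
    (gLe⇒GConnected (delete2 H u v) g'≤2)
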